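{- Let $H$ be a digraph (possibly with loops), $D$ a strongly connected $H$-colored digraph, and $\mathscr{F}$ a walk-preservative $H$-class partition of $A(D)$ such that $C_{\mathscr{F}}(D)$ has a $(k,l)$-kernel $\mathcal{S}$ (with $k\ge 2$, $l\ge 1$). Suppose that: (a) every cycle in $C_{\mathscr{F}}(D)$ is either a loop or has length at least $k$; and (b) for every $x\in V(D)$ with $N_{\mathscr{F}}(x)\cap\mathcal{S}\neq\emptyset$ and $N_{\mathscr{F}}(x)\cap N^{+}(\mathcal{S})\neq\emptyset$, we have $N^{ - }_{\mathscr{F}}(x)\subseteq\mathcal{S}$. Then $D$ has a $(k,l+1,H)$-kernel by walks.
   Context: An $H$-colored digraph is a finite digraph $D$ without loops with a coloring $\rho:A(D)\to V(H)$. For $F\subseteq A(D)$, $D\langle F\rangle$ is the digraph with arc set $F$ and vertex set the vertices incident with an arc of $F$. An $H$-class partition of $A(D)$ is a partition $\mathscr{F}$ of $A(D)$ such that for all arcs $(u,v),(v,w)$ of $D$, $(\rho(u,v),\rho(v,w))\in A(H)$ iff some $F\in\mathscr{F}$ contains both arcs. The $H$-class digraph $C_{\mathscr{F}}(D)$ has vertex set $\mathscr{F}$, and $(F,G)$ (possibly a loop) is an arc iff there exist $(u,v)\in F$ and $(v,w)\in G$. $\mathscr{F}$ is walk-preservative if for every arc $(F,G)$ of $C_{\mathscr{F}}(D)$ and every $z\in V(D\langle F\rangle)$ there is a $zw$-path in $D\langle F\rangle$ for some $w\in V(D\langle G\rangle)$. For $x\in V(D)$: $N^-_{\mathscr{F}}(x)=\{F\in\mathscr{F}:(u,x)\in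 F \text{ for some } u\}$, $N^+_{\mathscr{F}}(x)=\{F\in\mathscr{F}:(x,v)\in F\text{ for some }v\}$, $N_{\mathscr{F}}(x)=N^+_{\mathscr{F}}(x)\cup N^-_{\mathscr{F}}(x)$. $N^+(\mathcal{S})$ is the proper out-neighborhood of $\mathcal{S}$ in $C_{\mathscr{F}}(D)$ (vertices outside $\mathcal{S}$ receiving an arc from $\mathcal{S}$). A $(k,l)$-kernel of a digraph is a set $S$ such that every walk between two different vertices of $S$ has length at least $k$ and every vertex not in $S$ has a walk of length at most $l$ to $S$. For a walk $W=(x_0,\ldots,x_n)$ in $D$, there is an obstruction on $x_i$ if $(\rho(x_{i-1},x_i),\rho(x_i,x_{i+1}))\notin A(H)$; for open $W$, $l_H(W)$ is $1$ plus the number of $i\in\{1,\dots,n-1\}$ with an obstruction on $x_i$. A set $S\subseteq V(D)$ is a $(k,l,H)$-kernel by walks if every walk between two different vertices of $S$ has $H$-length at least $k$ and every $x\notin S$ has a walk to $S$ of $H$-length at most $l$. -}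

module Defs where

open import Data.Nat using (ℕ; zero; suc; _≤_)
open import Data.Fin using (Fin; zero; suc; inject₁; fromℕ)
open import Data.Bool using (Bool; true; false; T)
open import Data.Product using (Σ; ∃; ∃-syntax; _×_; _,_)
open import Data.Sum using (_⊎_)
open import Data.Fin.Subset using (Subset; _∈_; _∉_)
open import Relation.Nullary using (¬_)
open import Relation.Binary.PropositionalEquality using (_≡_; _≢_)

data WalkL {A : Set} (R : A → A → Set) : A → A → ℕ → Set where
  nil  : ∀ {x} → WalkL R x x 0
  cons : ∀ {x y z ℓ} → R x y → WalkL R y z ℓ → WalkL R x z (suc ℓ)

KLKernel : ∀ {p} → (Fin p → Fin p → Set) → ℕ → ℕ → Subset p → Set
KLKernel R k l S =
  (∀ x y → x ∈ S → y ∈ S → x ≢ y → ∀ ℓ → WalkL R x y ℓ → k ≤ ℓ) ×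
  (∀ x → x ∉ S → ∃[ y ] (y ∈ S × ∃[ ℓ ] (ℓ ≤ l × WalkL R x y ℓ)))

-- Every cycle is a loop or has length at least k.  A cycle of length
-- suc j is an injective sequence c 0, …, c j of vertices with arcs
-- c i → c (i+1) and c j → c 0.
CyclesLoopOrLong : ∀ {p} → (Fin p → Fin p → Set) → ℕ → Set
CyclesLoopOrLong {p} R k =
  ∀ j (c : Fin (suc j) → Fin p) →
  (∀ i i′ → c i ≡ c i′ → i ≡ i′) →
  (∀ (i : Fin j) → R (c (inject₁ i)) (c (suc i))) →
  R (c (fromℕ j)) (c zero) →
  j ≡ 0 ⊎ k ≤ suc j

-- Arcs are given by a Boolean adjacency function (no loops); the
-- coloring ρ is a function on pairs, only its values on arcs matter.
record HColored (m n : ℕ) : Set where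
  field
    E        : Fin n → Fin n → Bool
    loopless : ∀ u → E u u ≡ false
    ρ        : Fin n → Fin n → Fin m

module _ {m n : ℕ} (D : HColored m n) where
  open HColored D

  ArcD : Fin n → Fin n → Set
  ArcD u v = T (E u v)

  StronglyConnected : Set
  StronglyConnected = ∀ x y → ∃[ ℓ ] WalkL ArcD x y ℓ

  module _ {p : ℕ} (cls : Fin n → Fin n → Fin p) where
    -- The partition 𝓕 is indexed by Fin p; cls assigns to every arc its class.
    -- (u,v) is an arc of class F
    InClass : Fin p → Fin n → Fin n → Set
    InClass F u v = ArcD u v × cls u v ≡ F

    VIn : Fin p → Fin n → Set
    VIn F z = ∃[ v ] (InClass F z v ⊎ InClass F v z)

    ClassArc : Fin p → Fin p → Set
    ClassArc F G = ∃[ u ] ∃[ v ] ∃[ w ]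
      (ArcD u v × ArcD v w × cls u v ≡ F × cls v w ≡ G)

    WalkPreservative : Set
    WalkPreservative = ∀ F G → ClassArc F G → ∀ z → VIn F z →
      ∃[ w ] (VIn G w × ∃[ ℓ ] WalkL (InClass F) z w ℓ)

    N⁻ N⁺ N : Fin n → Fin p → Set
    N⁻ x F = ∃[ u ] InClass F u x
    N⁺ x F = ∃[ v ] InClass F x v
    N x F = N⁺ x F ⊎ N⁻ x F

    OutNbhd : Subset p → Fin p → Set
    OutNbhd S G = G ∉ S × ∃[ F ] (F ∈ S × ClassArc F G)

    CondB : Subset p → Set
    CondB S = ∀ x → (∃[ F ] (N x F × F ∈ S)) → (∃[ G ] (N x G × OutNbhd S G)) →
      ∀ F → N⁻ x F → F ∈ S

module _ {m n : ℕ} (HE : Fin m → Fin m → Bool) (D : HColored m n) where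
  open HColored D

  HArc : Fin m → Fin m → Set
  HArc a b = T (HE a b)

  IsHClassPartition : ∀ {p} → (Fin n → Fin n → Fin p) → Set
  IsHClassPartition {p} cls =
    (∀ (F : Fin p) → ∃[ u ] ∃[ v ] (ArcD D u v × cls u v ≡ F)) ×
    (∀ u v w → ArcD D u v → ArcD D v w →
       (HArc (ρ u v) (ρ v w) → cls u v ≡ cls v w) ×
       (cls u v ≡ cls v w → HArc (ρ u v) (ρ v w)))

  -- HW u v y ℓ : a walk (u, v, …, y) in D whose first arc is (u,v),
  -- with H-length ℓ (1 + number of obstructions on interior vertices).
  data HW : Fin n → Fin n → Fin n → ℕ → Set where
    one : ∀ {u v} → ArcD D u v → HW u v v 1
    ok  : ∀ {u v w y ℓ} → ArcD D u v → HArc (ρ u v) (ρ v w) →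
          HW v w y ℓ → HW u v y ℓ
    obs : ∀ {u v w y ℓ} → ArcD D u v → ¬ HArc (ρ u v) (ρ v w) →
          HW v w y ℓ → HW u v y (suc ℓ)

  WalkH : Fin n → Fin n → ℕ → Set
  WalkH x y ℓ = ∃[ v ] HW x v y ℓ

  KernelByWalks : ℕ → ℕ → Subset n → Set
  KernelByWalks k l S =
    (∀ x y → x ∈ S → y ∈ S → x ≢ y → ∀ ℓ → WalkH x y ℓ → k ≤ ℓ) ×
    (∀ x → x ∉ S → ∃[ y ] (y ∈ S × ∃[ ℓ ] (ℓ ≤ l × WalkH x y ℓ)))

-- The kernel K takes, for every F ∈ S and every terminal strong component of D⟨F⟩, the least vertex x
-- of that component which is entered by an arc of class F and has N⁻(x) ⊆ S. Such a vertex exists: if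
-- every class lies in S any vertex entered in class F will do, and otherwise walk-preservation leads from
-- the component into a class outside S adjacent from F, where hypothesis (b) applies.
--
-- Absorption: from x ∉ K, the (k,l)-kernel gives a walk of at most l steps in C(D) from a class at x to S.
-- Walk-preservation realizes it in D, one class per step, followed by a walk inside the final class to K;
-- consecutive arcs of one class carry no obstruction, so the H-length is at most l + 1.
--
-- Independence: an H-walk of H-length ℓ from x ∈ K to y ∈ K changes class exactly ℓ - 1 times, so it gives
-- a loop-free walk of length ℓ - 1 in C(D) from its first class to a class entering y, which lies in S.
-- Prefixed by the class of x it becomes a walk from S to S of length ℓ, hence ℓ ≥ k by the kernel property,
-- or by (a) if it is closed. When the walk already starts in the class of x, length ℓ - 1 suffices for
-- ℓ ≥ 2, while ℓ = 1 would mean that x reaches y inside D⟨F⟩ for that class F, impossible for two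
-- distinct representatives.
-- The argument does not use l ≥ 1.

module Submission where

open import Defs
open import Data.Nat using (ℕ; suc; _≤_)
open import Data.Fin using (Fin)
open import Data.Bool using (Bool)
open import Data.Product using (Σ)
open import Data.Fin.Subset using (Subset)

open import Data.Nat using (zero; _+_; _∸_; _<_; z≤n; s≤s; _≤?_)
open import Data.Nat.Properties
  using (≤-refl; ≤-trans; <⇒≤; ≰⇒>; m<n⇒m<1+n; m≤n⇒m≤1+n; n≤1+n; m∸n≤m;
         ∸-monoˡ-≤; m+[n∸m]≡n; m<n⇒0<n∸m; +-monoˡ-<)
open import Data.Nat.Induction using (<-wellFounded)
open import Data.Fin as Fin using (zero; suc; toℕ; inject₁; fromℕ)
open import Data.Fin.Properties
  using (_≟_; _<?_; <-cmp; any?; all?; ¬∀⟶∃¬; pigeonhole;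
         toℕ<n; toℕ≤n; toℕ≤pred[n]; toℕ-inject₁; toℕ-fromℕ)
  renaming (≤-antisym to Fin-≤-antisym)
open import Data.Fin.Subset using (_∈_; _∉_; _⊂_; ∣_∣)
open import Data.Fin.Subset.Properties using (_∈?_; p⊂q⇒∣p∣<∣q∣)
open import Data.Vec using (tabulate)
open import Data.Vec.Properties using (lookup∘tabulate; []=⇒lookup; lookup⇒[]=)
open import Data.Bool using (T; T?)
open import Data.Product using (∃; ∃-syntax; _×_; _,_; proj₁; proj₂)
open import Data.Sum using (_⊎_; inj₁; inj₂)
open import Data.Empty using (⊥-elim)
open import Function using (_∘_)
open import Induction.WellFounded using (Acc; acc)
open import Relation.Binary.Definitions using (tri<; tri≈; tri>)
open import Relation.Nullary using (¬_; Dec; yes; no; does; contradiction)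
open import Relation.Nullary.Decidable using (_×-dec_; _→-dec_; dec-true; dec-false; decidable-stable)
open import Relation.Unary using (Decidable)
open import Relation.Binary.PropositionalEquality using (_≡_; _≢_; refl; sym; trans; cong; subst)

module _ {n : ℕ} {P : Fin n → Set} (P? : Decidable P) where

  subsetOf : Subset n
  subsetOf = tabulate (does ∘ P?)

  ∈-subsetOf⁺ : ∀ {x} → P x → x ∈ subsetOf
  ∈-subsetOf⁺ {x} px = lookup⇒[]= x subsetOf (trans (lookup∘tabulate _ x) (dec-true (P? x) px))

  ∈-subsetOf⁻ : ∀ {x} → x ∈ subsetOf → P x
  ∈-subsetOf⁻ {x} x∈ = decidable-stable (P? x) λ ¬px →
    contradiction (trans (sym (dec-false (P? x) ¬px)) (trans (sym (lookup∘tabulate _ x)) ([]=⇒lookup x∈))) λ ()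

least : ∀ {n} {P : Fin n → Set} → Decidable P → ∃ P → ∃[ i ] (P i × (∀ j → P j → i Fin.≤ j))
least {suc n} P? (i , pᵢ) with P? zero
... | yes p₀ = zero , p₀ , λ _ _ → z≤n
least P? (zero , pᵢ) | no ¬p₀ = ⊥-elim (¬p₀ pᵢ)
least P? (suc i , pᵢ) | no ¬p₀ with least (P? ∘ suc) (i , pᵢ)
... | j , pⱼ , j-least = suc j , pⱼ , λ where
  zero p₀ → ⊥-elim (¬p₀ p₀)
  (suc j′) pⱼ′ → s≤s (j-least j′ pⱼ′)

module _ {A : Set} {R : A → A → Set} where

  infixr 5 _++ʷ_

  _++ʷ_ : ∀ {x y z a b} → WalkL R x y a → WalkL R y z b → WalkL R x z (a + b)
  nil ++ʷ v = v
  cons r w ++ʷ v = cons r (w ++ʷ v)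

  -- Positions past the end of a walk read as its last vertex.
  vertexAt : ∀ {x y ℓ} → WalkL R x y ℓ → ℕ → A
  vertexAt {x} _ zero = x
  vertexAt {x} nil (suc i) = x
  vertexAt (cons _ w) (suc i) = vertexAt w i

  vertexAt-end : ∀ {x y ℓ} (w : WalkL R x y ℓ) → vertexAt w ℓ ≡ y
  vertexAt-end nil = refl
  vertexAt-end (cons _ w) = vertexAt-end w

  arcAt : ∀ {x y ℓ} (w : WalkL R x y ℓ) i → i < ℓ → R (vertexAt w i) (vertexAt w (suc i))
  arcAt (cons r _) zero _ = r
  arcAt (cons _ w) (suc i) (s≤s i<ℓ) = arcAt w i i<ℓ

  takeʷ : ∀ {x y ℓ} (w : WalkL R x y ℓ) i → i ≤ ℓ → WalkL R x (vertexAt w i) i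
  takeʷ _ zero _ = nil
  takeʷ (cons r w) (suc i) (s≤s i≤ℓ) = cons r (takeʷ w i i≤ℓ)

  dropʷ : ∀ {x y ℓ} (w : WalkL R x y ℓ) i → i ≤ ℓ → WalkL R (vertexAt w i) y (ℓ ∸ i)
  dropʷ w zero _ = w
  dropʷ (cons _ w) (suc i) (s≤s i≤ℓ) = dropʷ w i i≤ℓ

  vertexAt-dropʷ : ∀ {x y ℓ} (w : WalkL R x y ℓ) i j (i≤ℓ : i ≤ ℓ) →
                   vertexAt (dropʷ w i i≤ℓ) j ≡ vertexAt w (i + j)
  vertexAt-dropʷ w zero j _ = refl
  vertexAt-dropʷ (cons _ w) (suc i) j (s≤s i≤ℓ) = vertexAt-dropʷ w i j i≤ℓ

  segment : ∀ {x y ℓ i j} (w : WalkL R x y ℓ) → i ≤ j → j ≤ ℓ →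
            WalkL R (vertexAt w i) (vertexAt w j) (j ∸ i)
  segment {i = i} {j} w i≤j j≤ℓ =
    subst (λ z → WalkL R (vertexAt w i) z (j ∸ i)) end
      (takeʷ (dropʷ w i i≤ℓ) (j ∸ i) (∸-monoˡ-≤ i j≤ℓ))
    where
    i≤ℓ = ≤-trans i≤j j≤ℓ
    end : vertexAt (dropʷ w i i≤ℓ) (j ∸ i) ≡ vertexAt w j
    end = trans (vertexAt-dropʷ w i (j ∸ i) i≤ℓ) (cong (vertexAt w) (m+[n∸m]≡n i≤j))

  excise : ∀ {x y ℓ i j} (w : WalkL R x y ℓ) → i < j → j ≤ ℓ → vertexAt w i ≡ vertexAt w j →
           ∃[ ℓ′ ] (ℓ′ < ℓ × WalkL R x y ℓ′)
  excise {y = y} {ℓ} {i} {j} w i<j j≤ℓ same =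
    i + (ℓ ∸ j) , shorter ,
    takeʷ w i (≤-trans (<⇒≤ i<j) j≤ℓ) ++ʷ
    subst (λ z → WalkL R z y (ℓ ∸ j)) (sym same) (dropʷ w j j≤ℓ)
    where
    shorter : i + (ℓ ∸ j) < ℓ
    shorter = subst (i + (ℓ ∸ j) <_) (m+[n∸m]≡n j≤ℓ) (+-monoˡ-< (ℓ ∸ j) i<j)

  last-arc : ∀ {x y ℓ} → WalkL R x y (suc ℓ) → ∃[ u ] R u y
  last-arc (cons r nil) = _ , r
  last-arc (cons _ (cons r w)) = last-arc (cons r w)

mapʷ : ∀ {A : Set} {R Q : A → A → Set} → (∀ {a b} → R a b → Q a b) →
       ∀ {x y ℓ} → WalkL R x y ℓ → WalkL Q x y ℓ
mapʷ f nil = nil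
mapʷ f (cons r w) = cons (f r) (mapʷ f w)

Reach : ∀ {A : Set} → (A → A → Set) → A → A → Set
Reach R x y = ∃[ ℓ ] WalkL R x y ℓ

reach-refl : ∀ {A : Set} {R : A → A → Set} {x} → Reach R x x
reach-refl = 0 , nil

reach-trans : ∀ {A : Set} {R : A → A → Set} {x y z} → Reach R x y → Reach R y z → Reach R x z
reach-trans (_ , w) (_ , v) = _ , w ++ʷ v

Terminal : ∀ {A : Set} → (A → A → Set) → A → Set
Terminal R t = ∀ y → Reach R t y → Reach R y t

terminal-reach : ∀ {A : Set} {R : A → A → Set} {t y} → Terminal R t → Reach R t y → Terminal R y
terminal-reach t-term t⇝y z y⇝z = reach-trans (t-term z (reach-trans t⇝y y⇝z)) t⇝y

module _ {n : ℕ} {R : Fin n → Fin n → Set} where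

  shorten : ∀ {x y ℓ} → WalkL R x y ℓ → ∃[ ℓ′ ] (ℓ′ ≤ n × WalkL R x y ℓ′)
  shorten {ℓ = ℓ} = go (<-wellFounded ℓ)
    where
    go : ∀ {x y ℓ} → Acc _<_ ℓ → WalkL R x y ℓ → ∃[ ℓ′ ] (ℓ′ ≤ n × WalkL R x y ℓ′)
    go {ℓ = ℓ} (acc smaller) w with ℓ ≤? n
    ... | yes ℓ≤n = ℓ , ℓ≤n , w
    ... | no ℓ≰n with pigeonhole (m<n⇒m<1+n (≰⇒> ℓ≰n)) (λ (i : Fin (suc ℓ)) → vertexAt w (toℕ i))
    ...   | i , j , i<j , same with excise w i<j (toℕ≤pred[n] j) same
    ...     | ℓ′ , ℓ′<ℓ , w′ = go (smaller ℓ′<ℓ) w′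

  module _ (R? : ∀ x y → Dec (R x y)) where

    reach≤? : ∀ b x y → Dec (∃[ ℓ ] (ℓ ≤ b × WalkL R x y ℓ))
    reach≤? b x y with x ≟ y
    ... | yes refl = yes (0 , z≤n , nil)
    reach≤? zero x y | no x≢y = no λ where (.0 , z≤n , nil) → x≢y refl
    reach≤? (suc b) x y | no x≢y with any? (λ z → R? x z ×-dec reach≤? b z y)
    ... | yes (z , r , ℓ , ℓ≤b , w) = yes (suc ℓ , s≤s ℓ≤b , cons r w)
    ... | no no-step = no λ where
      (.0 , _ , nil) → x≢y refl
      (suc ℓ , s≤s ℓ≤b , cons r w) → no-step (_ , r , ℓ , ℓ≤b , w)

    reach? : ∀ x y → Dec (Reach R x y)
    reach? x y with reach≤? n x y
    ... | yes (ℓ , _ , w) = yes (ℓ , w)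
    ... | no unreachable = no λ (_ , w) → unreachable (shorten w)

    terminal? : ∀ t → Dec (Terminal R t)
    terminal? t = all? λ y → reach? t y →-dec reach? y t

    nonterminal-escape : ∀ {x} → ¬ Terminal R x → ∃[ y ] (Reach R x y × ¬ Reach R y x)
    nonterminal-escape {x} ¬term with ¬∀⟶∃¬ n _ (λ y → reach? x y →-dec reach? y x) ¬term
    ... | y , ¬back =
      y , decidable-stable (reach? x y) (λ ¬x⇝y → ¬back (⊥-elim ∘ ¬x⇝y)) , λ y⇝x → ¬back (λ _ → y⇝x)

    -- Leaving x for a vertex that cannot return strictly shrinks the set of reachable vertices.
    reaches-terminal : ∀ x → ∃[ t ] (Reach R x t × Terminal R t)
    reaches-terminal x = go x (<-wellFounded ∣ reachable x ∣)
      where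
      reachable : Fin n → Subset n
      reachable x = subsetOf (reach? x)
      go : ∀ x → Acc _<_ ∣ reachable x ∣ → ∃[ t ] (Reach R x t × Terminal R t)
      go x (acc smaller) with terminal? x
      ... | yes x-term = x , reach-refl , x-term
      ... | no ¬x-term with nonterminal-escape ¬x-term
      ...   | y , x⇝y , ¬y⇝x with go y (smaller (p⊂q⇒∣p∣<∣q∣ shrinks))
        where
        shrinks : reachable y ⊂ reachable x
        shrinks = (λ z∈ → ∈-subsetOf⁺ (reach? x) (reach-trans x⇝y (∈-subsetOf⁻ (reach? y) z∈))) ,
                  x , ∈-subsetOf⁺ (reach? x) reach-refl , ¬y⇝x ∘ ∈-subsetOf⁻ (reach? y)
      ...     | t , y⇝t , t-term = t , reach-trans x⇝y y⇝t , t-term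

module _ {A : Set} {R : A → A → Set} {x : A} {j : ℕ} (w : WalkL R x x (suc j)) where

  cyclicSequence : Fin (suc j) → A
  cyclicSequence i = vertexAt w (toℕ i)

  cyclicSequence-step : ∀ (i : Fin j) → R (cyclicSequence (inject₁ i)) (cyclicSequence (suc i))
  cyclicSequence-step i =
    subst (λ a → R (vertexAt w a) (cyclicSequence (suc i))) (sym (toℕ-inject₁ i))
      (arcAt w (toℕ i) (≤-trans (toℕ<n i) (n≤1+n j)))

  cyclicSequence-close : R (cyclicSequence (fromℕ j)) (cyclicSequence zero)
  cyclicSequence-close =
    subst (λ a → R (vertexAt w a) x) (sym (toℕ-fromℕ j))
      (subst (R (vertexAt w j)) (vertexAt-end w) (arcAt w j ≤-refl))

injective-without-repeats : ∀ {n} {B : Set} (f : Fin n → B) →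
  ¬ (∃[ i ] ∃[ i′ ] (i Fin.< i′ × f i ≡ f i′)) → ∀ i i′ → f i ≡ f i′ → i ≡ i′
injective-without-repeats f no-repeat i i′ same with <-cmp i i′
... | tri< i<i′ _ _ = ⊥-elim (no-repeat (i , i′ , i<i′ , same))
... | tri≈ _ i≡i′ _ = i≡i′
... | tri> _ _ i′<i = ⊥-elim (no-repeat (i′ , i , i′<i , sym same))

module _ {p : ℕ} (R : Fin p → Fin p → Set) where

  ProperArc : Fin p → Fin p → Set
  ProperArc x y = R x y × x ≢ y

  no-closed-proper-arc : ∀ {x} → ¬ WalkL ProperArc x x 1
  no-closed-proper-arc (cons (_ , x≢x) nil) = x≢x refl

  -- A repeated vertex splits off a shorter closed walk; without one, the walk is a cycle.
  closed-walk-long : ∀ {k} → CyclesLoopOrLong R k → ∀ {x j} → WalkL ProperArc x x (suc j) → k ≤ suc j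
  closed-walk-long {k} cycles {j = j} = go (<-wellFounded j)
    where
    go : ∀ {x j} → Acc _<_ j → WalkL ProperArc x x (suc j) → k ≤ suc j
    go {x} {j} (acc smaller) w
      with any? (λ i → any? (λ i′ → (i <? i′) ×-dec (cyclicSequence w i ≟ cyclicSequence w i′)))
    ... | yes (i , i′ , i<i′ , same) =
      ≤-trans (shorter-closed (m<n⇒0<n∸m i<i′) L≤j closed) (≤-trans L≤j (n≤1+n j))
      where
      L≤j : toℕ i′ ∸ toℕ i ≤ j
      L≤j = ≤-trans (m∸n≤m (toℕ i′) (toℕ i)) (toℕ≤pred[n] i′)
      closed : WalkL ProperArc (cyclicSequence w i) (cyclicSequence w i) (toℕ i′ ∸ toℕ i)
      closed = subst (λ z → WalkL ProperArc (cyclicSequence w i) z _) (sym same)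
                 (segment w (<⇒≤ i<i′) (toℕ≤n i′))
      shorter-closed : ∀ {y L} → 0 < L → L ≤ j → WalkL ProperArc y y L → k ≤ L
      shorter-closed {L = suc d} _ L≤j closed = go (smaller L≤j) closed
    ... | no no-repeat
      with cycles j (cyclicSequence w) (injective-without-repeats _ no-repeat)
             (proj₁ ∘ cyclicSequence-step w) (proj₁ (cyclicSequence-close w))
    ...   | inj₂ long = long
    ...   | inj₁ refl = ⊥-elim (no-closed-proper-arc w)

  KLKernel-independent : ∀ {k l S} → 2 ≤ k → KLKernel R k l S →
                         ∀ {F G} → F ∈ S → G ∈ S → R F G → F ≡ G
  KLKernel-independent 2≤k (separated , _) {F} {G} F∈S G∈S F→G with F ≟ G
  ... | yes F≡G = F≡G
  ... | no F≢G = ⊥-elim (2≰1 (≤-trans 2≤k (separated F G F∈S G∈S F≢G 1 (cons F→G nil))))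
    where
    2≰1 : ¬ (2 ≤ 1)
    2≰1 (s≤s ())

  KLKernel-within : ∀ {k l S} → KLKernel R k l S →
                    ∀ F → ∃[ G ] (G ∈ S × ∃[ j ] (j ≤ l × WalkL R F G j))
  KLKernel-within {S = S} (_ , absorbing) F with F ∈? S
  ... | yes F∈S = F , F∈S , 0 , z≤n , nil
  ... | no F∉S = absorbing F F∉S

  KLKernel-walk-long : ∀ {k l S} → KLKernel R k l S → CyclesLoopOrLong R k →
                       ∀ {F G L} → F ∈ S → G ∈ S → WalkL ProperArc F G (suc L) → k ≤ suc L
  KLKernel-walk-long (separated , _) cycles {F} {G} {L} F∈S G∈S w with F ≟ G
  ... | yes refl = closed-walk-long cycles w
  ... | no F≢G = separated F G F∈S G∈S F≢G (suc L) (mapʷ proj₁ w)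

module _ {m n p : ℕ} (D : HColored m n) (cls : Fin n → Fin n → Fin p) where
  open HColored D

  InClass? : ∀ F u v → Dec (InClass D cls F u v)
  InClass? F u v = T? (E u v) ×-dec (cls u v ≟ F)

  N⁻? : ∀ x F → Dec (N⁻ D cls x F)
  N⁻? x F = any? (λ u → InClass? F u x)

  VIn⇒N : ∀ {F z} → VIn D cls F z → N D cls z F
  VIn⇒N (v , inj₁ z→v) = inj₁ (v , z→v)
  VIn⇒N (v , inj₂ v→z) = inj₂ (v , v→z)

  VIn-reach : ∀ {F z t ℓ} → VIn D cls F z → WalkL (InClass D cls F) z t ℓ → VIn D cls F t
  VIn-reach z∈F nil = z∈F
  VIn-reach {z = z} _ (cons z→y w) = VIn-reach (z , inj₂ z→y) w

  -- An arc w → v of class F forces a walk back from v, nonempty as D is loopless; its last arc enters w.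
  terminal-entered : ∀ {F w} → Terminal (InClass D cls F) w → VIn D cls F w → N⁻ D cls w F
  terminal-entered _ (v , inj₂ v→w) = v , v→w
  terminal-entered {w = w} w-term (v , inj₁ w→v) with w-term v (1 , cons w→v nil)
  ... | 0 , nil = ⊥-elim (subst T (loopless w) (proj₁ w→v))
  ... | suc _ , v⇝w = last-arc v⇝w

  class-change : ∀ {F a b c d ℓ} → InClass D cls F a b → WalkL (ArcD D) b c ℓ →
                 ArcD D c d → cls c d ≢ F →
                 ∃[ G ] (ClassArc D cls F G × G ≢ F)
  class-change {a = a} {b} {d = d} (a→b , class) nil b→d changed =
    cls b d , (a , b , d , a→b , b→d , class , refl) , changed
  class-change {F} {a} {b} (a→b , class) (cons {y = b′} b→b′ w) c→d changed with cls b b′ ≟ F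
  ... | yes same = class-change (b→b′ , same) w c→d changed
  ... | no other = cls b b′ , (a , b , b′ , a→b , b→b′ , class , refl) , other

  module _ (S : Subset p) where

    Anchored : Fin p → Fin n → Set
    Anchored F x = N⁻ D cls x F × (∀ G → N⁻ D cls x G → G ∈ S)

    Anchored? : ∀ F x → Dec (Anchored F x)
    Anchored? F x = N⁻? x F ×-dec all? (λ G → N⁻? x G →-dec (G ∈? S))

    Representative : Fin p → Fin n → Set
    Representative F x =
      Anchored F x × Terminal (InClass D cls F) x ×
      (∀ y → Reach (InClass D cls F) x y → Anchored F y → x Fin.≤ y)

    Representative? : ∀ F x → Dec (Representative F x)
    Representative? F x =
      Anchored? F x ×-dec terminal? (InClass? F) x ×-dec
      all? (λ y → reach? (InClass? F) x y →-dec Anchored? F y →-dec (toℕ x ≤? toℕ y))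

    Represented : Fin n → Set
    Represented x = ∃[ F ] (F ∈ S × Representative F x)

    Represented? : ∀ x → Dec (Represented x)
    Represented? x = any? (λ F → (F ∈? S) ×-dec Representative? F x)

    kernel : Subset n
    kernel = subsetOf Represented?

module _ {m n : ℕ} (HE : Fin m → Fin m → Bool) (D : HColored m n) where
  open HColored D

  HW-first-arc : ∀ {u v y ℓ} → HW HE D u v y ℓ → ArcD D u v
  HW-first-arc (one a) = a
  HW-first-arc (ok a _ _) = a
  HW-first-arc (obs a _ _) = a

  HW-nonzero : ∀ {u v y} → ¬ HW HE D u v y 0
  HW-nonzero (ok _ _ rest) = HW-nonzero rest

  -- Joining two H-walks creates at most one new obstruction, at the junction.
  HW-append : ∀ {u v y w z a b} → HW HE D u v y a → HW HE D y w z b →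
              ∃[ c ] (c ≤ a + b × HW HE D u v z c)
  HW-append {u} {y = y} {w} {b = b} (one u→y) second with T? (HE (ρ u y) (ρ y w))
  ... | yes fits = b , n≤1+n b , ok u→y fits second
  ... | no clash = suc b , ≤-refl , obs u→y clash second
  HW-append (ok u→v fits first) second with HW-append first second
  ... | c , c≤ , walk = c , c≤ , ok u→v fits walk
  HW-append (obs u→v clash first) second with HW-append first second
  ... | c , c≤ , walk = suc c , s≤s c≤ , obs u→v clash walk

  HReach≤ : ℕ → Fin n → Fin n → Set
  HReach≤ b z κ = z ≡ κ ⊎ ∃[ ℓ ] (ℓ ≤ b × WalkH HE D z κ ℓ)

  module _ {p : ℕ} (cls : Fin n → Fin n → Fin p) where

    module _ (partition : IsHClassPartition HE D cls) where

      class-inhabited : ∀ F → ∃[ u ] ∃[ v ] InClass D cls F u v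
      class-inhabited = proj₁ partition

      same-class⇒H-arc : ∀ {u v w} → ArcD D u v → ArcD D v w →
                         cls u v ≡ cls v w → HArc HE D (ρ u v) (ρ v w)
      same-class⇒H-arc u→v v→w = proj₂ (proj₂ partition _ _ _ u→v v→w)

      H-arc⇒same-class : ∀ {u v w} → ArcD D u v → ArcD D v w →
                         HArc HE D (ρ u v) (ρ v w) → cls u v ≡ cls v w
      H-arc⇒same-class u→v v→w = proj₁ (proj₂ partition _ _ _ u→v v→w)

      in-class-walk⇒HW : ∀ {G z y s} → WalkL (InClass D cls G) z y (suc s) →
                         ∃[ v ] (cls z v ≡ G × HW HE D z v y 1)
      in-class-walk⇒HW (cons (z→y , class) nil) = _ , class , one z→y
      in-class-walk⇒HW (cons (z→z′ , class) (cons step rest)) with in-class-walk⇒HW (cons step rest)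
      ... | v , class′ , walk =
        _ , class , ok z→z′ (same-class⇒H-arc z→z′ (HW-first-arc walk) (trans class (sym class′))) walk

      HReach≤-prepend-in-class : ∀ {G z y s b κ} → WalkL (InClass D cls G) z y s →
                                 HReach≤ b y κ → HReach≤ (suc b) z κ
      HReach≤-prepend-in-class nil (inj₁ y≡κ) = inj₁ y≡κ
      HReach≤-prepend-in-class nil (inj₂ (ℓ , ℓ≤b , walk)) = inj₂ (ℓ , m≤n⇒m≤1+n ℓ≤b , walk)
      HReach≤-prepend-in-class w@(cons _ _) rest with in-class-walk⇒HW w | rest
      ... | v , _ , first | inj₁ refl = inj₂ (1 , s≤s z≤n , v , first)
      ... | v , _ , first | inj₂ (ℓ , ℓ≤b , _ , second) with HW-append first second
      ...   | c , c≤ , walk = inj₂ (c , ≤-trans c≤ (s≤s ℓ≤b) , v , walk)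

      -- Every obstruction of an H-walk is a change of class, and vice versa.
      HW⇒class-walk : ∀ {u v y ℓ} → HW HE D u v y ℓ →
                      ∃[ G ] (N⁻ D cls y G ×
                              ∃[ L ] (suc L ≡ ℓ × WalkL (ProperArc (ClassArc D cls)) (cls u v) G L))
      HW⇒class-walk {u} {v} (one u→v) = cls u v , (u , u→v , refl) , 0 , refl , nil
      HW⇒class-walk (ok u→v fits rest) with HW⇒class-walk rest
      ... | G , enters , L , refl , w =
        G , enters , L , refl ,
        subst (λ F → WalkL (ProperArc (ClassArc D cls)) F G L)
              (sym (H-arc⇒same-class u→v (HW-first-arc rest) fits)) w
      HW⇒class-walk {u} {v} (obs u→v clash rest) with HW⇒class-walk rest
      ... | G , enters , L , refl , w =
        G , enters , suc L , refl ,
        cons ((u , v , _ , u→v , HW-first-arc rest , refl , refl) ,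
              clash ∘ same-class⇒H-arc u→v (HW-first-arc rest)) w

      HW-unobstructed⇒in-class : ∀ {u v y} → HW HE D u v y 1 → Reach (InClass D cls (cls u v)) u y
      HW-unobstructed⇒in-class (one u→v) = 1 , cons (u→v , refl) nil
      HW-unobstructed⇒in-class {u} {v} (ok u→v fits rest) with HW-unobstructed⇒in-class rest
      ... | s , w = suc s , cons (u→v , refl)
        (subst (λ G → WalkL (InClass D cls G) v _ s) (sym (H-arc⇒same-class u→v (HW-first-arc rest) fits)) w)
      HW-unobstructed⇒in-class (obs _ _ rest) = ⊥-elim (HW-nonzero rest)

module _ {m n p : ℕ} (HE : Fin m → Fin m → Bool) (D : HColored m n) (cls : Fin n → Fin n → Fin p)
         (partition : IsHClassPartition HE D cls) {S : Subset p} {k l : ℕ} (2≤k : 2 ≤ k)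
         (S-kernel : KLKernel (ClassArc D cls) k l S) where

  independent : ∀ {F G} → F ∈ S → G ∈ S → ClassArc D cls F G → F ≡ G
  independent = KLKernel-independent (ClassArc D cls) 2≤k S-kernel

  -- The arc entering y in class G and the first arc of the walk back y ⇝ x give G → F in C(D), so G = F.
  representatives-unreachable : ∀ {x y F G} → x ≢ y → F ∈ S → G ∈ S →
    Representative D cls S F x → Representative D cls S G y → ¬ Reach (InClass D cls F) x y
  representatives-unreachable x≢y F∈S G∈S (x-anchored , x-terminal , x-least)
                              (y-anchored@((b , b→y , b-class) , _) , _ , y-least) x⇝y
    with x-terminal _ x⇝y
  ... | 0 , nil = x≢y refl
  ... | suc s , y⇝x@(cons (y→y′ , class) _)
    with independent G∈S F∈S (b , _ , _ , b→y , y→y′ , b-class , class)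
  ...   | refl = x≢y (Fin-≤-antisym (x-least _ x⇝y y-anchored) (y-least _ (suc s , y⇝x) x-anchored))

  module _ (cycles : CyclesLoopOrLong (ClassArc D cls) k) where

    kernel-separated : ∀ x y → x ∈ kernel D cls S → y ∈ kernel D cls S → x ≢ y →
                       ∀ ℓ → WalkH HE D x y ℓ → k ≤ ℓ
    kernel-separated x y x∈K y∈K x≢y _ (v , walk)
      with ∈-subsetOf⁻ (Represented? D cls S) x∈K | ∈-subsetOf⁻ (Represented? D cls S) y∈K
         | HW⇒class-walk HE D cls partition walk
    ... | F , F∈S , x-rep | G , G∈S , y-rep | Gₗ , y-entered , L , refl , class-walk =
      by-first-class (F ≟ cls x v) class-walk walk
      where
      long : ∀ {L′} → WalkL (ProperArc (ClassArc D cls)) F Gₗ (suc L′) → k ≤ suc L′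
      long = KLKernel-walk-long (ClassArc D cls) S-kernel cycles F∈S (proj₂ (proj₁ y-rep) Gₗ y-entered)
      entering : ClassArc D cls F (cls x v)
      entering with proj₁ (proj₁ x-rep)
      ... | a , a→x , a-class = a , x , v , a→x , HW-first-arc HE D walk , a-class , refl
      by-first-class : ∀ {L′} → Dec (F ≡ cls x v) → WalkL (ProperArc (ClassArc D cls)) (cls x v) Gₗ L′ →
                       HW HE D x v y (suc L′) → k ≤ suc L′
      by-first-class (no F≢first) w _ = long (cons (entering , F≢first) w)
      by-first-class (yes F≡first) nil walk′ =
        ⊥-elim (representatives-unreachable x≢y F∈S G∈S x-rep y-rep
          (subst (λ H → Reach (InClass D cls H) x y) (sym F≡first)
                 (HW-unobstructed⇒in-class HE D cls partition walk′)))
      by-first-class (yes F≡first) w@(cons _ _) _ =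
        m≤n⇒m≤1+n (long (subst (λ H → WalkL (ProperArc (ClassArc D cls)) H Gₗ _) (sym F≡first) w))

  module _ (strong : StronglyConnected D) (preservative : WalkPreservative D cls) (condB : CondB D cls S) where

    -- cls x x is merely some class; x reaches the tail of one of its arcs.
    out-arc : ∀ x → ∃[ y ] ArcD D x y
    out-arc x with class-inhabited HE D cls partition (cls x x)
    ... | u , v , (u→v , _) with strong x u
    ...   | 0 , nil = v , u→v
    ...   | suc _ , cons x→y _ = _ , x→y

    exit-from-kernel : ∀ {F G} → F ∈ S → G ∉ S → ∃[ G′ ] (ClassArc D cls F G′ × G′ ∉ S)
    exit-from-kernel {F} {G} F∈S G∉S
      with class-inhabited HE D cls partition F | class-inhabited HE D cls partition G
    ... | u , v , in-F | c , d , (c→d , d-class) with strong v c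
    ...   | _ , v⇝c with class-change D cls in-F v⇝c c→d G≢F
      where
      G≢F : cls c d ≢ F
      G≢F G≡F = G∉S (subst (_∈ S) (trans (sym G≡F) d-class) F∈S)
    ...     | G′ , F→G′ , G′≢F =
      G′ , F→G′ , λ G′∈S → G′≢F (sym (independent F∈S G′∈S F→G′))

    reaches-anchored : ∀ {F t} → F ∈ S → Terminal (InClass D cls F) t → VIn D cls F t →
                       ∃[ w ] (Reach (InClass D cls F) t w × Anchored D cls S F w)
    reaches-anchored {F} {t} F∈S t-terminal t∈F with all? (_∈? S)
    ... | yes everything-in-S =
      t , reach-refl , terminal-entered D cls t-terminal t∈F , λ G _ → everything-in-S G
    ... | no ¬everything-in-S with exit-from-kernel F∈S (proj₂ (¬∀⟶∃¬ p _ (_∈? S) ¬everything-in-S))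
    ...   | G , F→G , G∉S with preservative F G F→G t t∈F
    ...     | w , w∈G , ℓ , t⇝w =
      w , (ℓ , t⇝w) , w-entered ,
      condB w (F , inj₂ w-entered , F∈S) (G , VIn⇒N D cls w∈G , G∉S , F , F∈S , F→G)
      where
      w-entered : N⁻ D cls w F
      w-entered = terminal-entered D cls (terminal-reach t-terminal (ℓ , t⇝w)) (VIn-reach D cls t∈F t⇝w)

    absorbed-in-class : ∀ {F z} → F ∈ S → VIn D cls F z →
                        ∃[ κ ] (κ ∈ kernel D cls S × Reach (InClass D cls F) z κ)
    absorbed-in-class {F} {z} F∈S z∈F with reaches-terminal (InClass? D cls F) z
    ... | t , z⇝t , t-terminal
      with least (λ y → reach? (InClass? D cls F) t y ×-dec Anchored? D cls S F y)
                 (reaches-anchored F∈S t-terminal (VIn-reach D cls z∈F (proj₂ z⇝t)))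
    ...   | κ , (t⇝κ , κ-anchored) , κ-least =
      κ , ∈-subsetOf⁺ (Represented? D cls S)
            (F , F∈S , κ-anchored , terminal-reach t-terminal t⇝κ , κ-least-from-κ) ,
      reach-trans z⇝t t⇝κ
      where
      κ-least-from-κ : ∀ y → Reach (InClass D cls F) κ y → Anchored D cls S F y → κ Fin.≤ y
      κ-least-from-κ y κ⇝y y-anchored = κ-least y (reach-trans t⇝κ κ⇝y , y-anchored)

    kernel-reachable : ∀ {G F j z} → WalkL (ClassArc D cls) G F j → F ∈ S → VIn D cls G z →
                       ∃[ κ ] (κ ∈ kernel D cls S × HReach≤ HE D (suc j) z κ)
    kernel-reachable nil F∈S z∈F with absorbed-in-class F∈S z∈F
    ... | κ , κ∈K , _ , z⇝κ = κ , κ∈K , HReach≤-prepend-in-class HE D cls partition z⇝κ (inj₁ refl)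
    kernel-reachable {z = z} (cons G→G′ rest) F∈S z∈G with preservative _ _ G→G′ z z∈G
    ... | w , w∈G′ , _ , z⇝w with kernel-reachable rest F∈S w∈G′
    ...   | κ , κ∈K , w-reaches = κ , κ∈K , HReach≤-prepend-in-class HE D cls partition z⇝w w-reaches

    kernel-absorbing : ∀ x → x ∉ kernel D cls S →
                       ∃[ y ] (y ∈ kernel D cls S × ∃[ ℓ ] (ℓ ≤ suc l × WalkH HE D x y ℓ))
    kernel-absorbing x x∉K with out-arc x
    ... | x′ , x→x′ with KLKernel-within (ClassArc D cls) S-kernel (cls x x′)
    ...   | F , F∈S , j , j≤l , class-walk
      with kernel-reachable class-walk F∈S (x′ , inj₁ (x→x′ , refl))
    ...     | κ , κ∈K , inj₁ refl = ⊥-elim (x∉K κ∈K)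
    ...     | κ , κ∈K , inj₂ (ℓ , ℓ≤ , walk) = κ , κ∈K , ℓ , ≤-trans ℓ≤ (s≤s j≤l) , walk

theorem6 : ∀ {m n p : ℕ} (HE : Fin m → Fin m → Bool) (D : HColored m n)
    (cls : Fin n → Fin n → Fin p) (S : Subset p) (k l : ℕ) →
    2 ≤ k → 1 ≤ l →
    StronglyConnected D →
    IsHClassPartition HE D cls →
    WalkPreservative D cls →
    KLKernel (ClassArc D cls) k l S →
    CyclesLoopOrLong (ClassArc D cls) k →
    CondB D cls S →
    Σ (Subset n) (λ K → KernelByWalks HE D k (suc l) K)
theorem6 HE D cls S k l 2≤k _ strong partition preservative S-kernel cycles condB =
  kernel D cls S ,
  kernel-separated HE D cls partition {S} {k} {l} 2≤k S-kernel cycles ,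
  kernel-absorbing HE D cls partition {S} {k} {l} 2≤k S-kernel strong preservative condB
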